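{- For almost all graphs $G$, if two distinct letters $a,b$ each appear twice in a lettering $w$ of $G$, then they appear in a crossing pattern ($\cdots a \cdots b \cdots a \cdots b \cdots$ or $\cdots b \cdots a \cdots b \cdots a \cdots$) or a nested pattern ($\cdots a \cdots b \cdots b \cdots a \cdots$ or $\cdots b \cdots a \cdots a \cdots b \cdots$), and never in a separated pattern ($\cdots a \cdots a \cdots b \cdots b \cdots$ or $\cdots b \cdots b \cdots a \cdots a \cdots$). That is, letting $G = G(n,\tfrac12)$, the probability that $G$ has a lettering in which two letters each appearing twice occur in a separated pattern tends to $0$ as $n\to\infty$.
   Context: For a finite alphabet $\Sigma$, a decoder is a set $D \subseteq \Sigma^2$ of ordered pairs. For a word $w = w(1)\cdots w(n)$ with letters in $\Sigma$, the letter graph $\Gamma_D(w)$ is the graph with vertex set $\{1,\dots,n\}$ and an edge between $i<j$ exactly when $(w(i),w(j)) \in D$. A word $w$ is a lettering of a graph $G$ if $\Gamma_D(w) \cong G$ for some decoder $D$. $G(n,\tfrac12)$ is the random graph on $n$ labeled vertices in which each edge is present independently with probability $\tfrac12$; "almost all graphs have property P" means that the probability that $G(n,\tfrac12)$ has P tends to $1$ as $n\to\infty$. -}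

module Defs where

open import Data.Nat using (ℕ; zero; suc; _<_)
open import Data.Fin using (Fin; zero; suc) renaming (_<_ to _<ᶠ_)
open import Data.Fin.Properties using (_<?_)
open import Data.Bool using (Bool; true; false)
open import Data.Unit using (⊤; tt)
open import Data.Vec using (Vec; lookup)
open import Data.Product using (Σ; _×_; _,_; ∃)
open import Data.Sum using (_⊎_)
open import Relation.Nullary using (¬_; yes; no)
open import Relation.Binary.PropositionalEquality using (_≡_)
open import Data.Fin.Permutation using (Permutation′; _⟨$⟩ʳ_)

-- A labelled graph on the vertex set Fin n, stored canonically as its
-- upper-triangular adjacency data: a graph on suc n vertices is the
-- adjacency row of the vertex 0 to the other n vertices, together with a
-- graph on the remaining n vertices.  There are exactly 2 ^ (n C 2) such
-- graphs, each arising exactly once, so the uniform distribution on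
-- LGraph n is G(n, 1/2).
LGraph : ℕ → Set
LGraph zero = ⊤
LGraph (suc n) = Vec Bool n × LGraph n

adj : ∀ {n} → LGraph n → Fin n → Fin n → Bool
adj {suc n} (v , g) zero    zero    = false
adj {suc n} (v , g) zero    (suc j) = lookup v j
adj {suc n} (v , g) (suc i) zero    = lookup v i
adj {suc n} (v , g) (suc i) (suc j) = adj g i j

Word : ℕ → ℕ → Set
Word m n = Fin n → Fin m

Decoder : ℕ → Set
Decoder m = Fin m → Fin m → Bool

letterAdj : ∀ {m n} → Decoder m → Word m n → Fin n → Fin n → Bool
letterAdj D w i j with i <? j | j <? i
... | yes _ | _     = D (w i) (w j)
... | no _  | yes _ = D (w j) (w i)
... | no _  | no _  = false

LetterGraphIso : ∀ {m n} → Decoder m → Word m n → LGraph n → Set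
LetterGraphIso {n = n} D w G =
  Σ (Permutation′ n) λ σ →
    ∀ i j → adj G (σ ⟨$⟩ʳ i) (σ ⟨$⟩ʳ j) ≡ letterAdj D w i j

IsLettering : ∀ {m n} → Word m n → LGraph n → Set
IsLettering w G = ∃ λ D → LetterGraphIso D w G

OccursTwiceAt : ∀ {m n} → Word m n → Fin m → Fin n → Fin n → Set
OccursTwiceAt w a p q =
  p <ᶠ q × w p ≡ a × w q ≡ a × (∀ r → w r ≡ a → r ≡ p ⊎ r ≡ q)

-- distinct letters a, b each occurring exactly twice in w, in the separated
-- pattern  ⋯a⋯a⋯b⋯b⋯  (the pattern ⋯b⋯b⋯a⋯a⋯ is the same with a, b swapped)
SeparatedPair : ∀ {m n} → Word m n → Set
SeparatedPair {m} {n} w =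
  Σ (Fin m) λ a → Σ (Fin m) λ b → ¬ (a ≡ b) ×
  Σ (Fin n) λ p₁ → Σ (Fin n) λ p₂ → Σ (Fin n) λ p₃ → Σ (Fin n) λ p₄ →
    OccursTwiceAt w a p₁ p₂ × OccursTwiceAt w b p₃ p₄ × p₂ <ᶠ p₃

HasSeparatedLettering : ∀ {n} → LGraph n → Set
HasSeparatedLettering {n} G =
  Σ ℕ λ m → Σ (Word m n) λ w → IsLettering w G × SeparatedPair w

-- If a lettering w of G has a separated pattern a⋯a⋯b⋯b⋯ at positions p₁ < p₂ < p₃ < p₄,
-- then a vertex placed before p₃ is adjacent to p₃ iff to p₄ (both edges are decided by the same
-- letter pair), and every other vertex lies after p₂, so it is adjacent to p₁ iff to p₂.
-- Thus G has vertices v₁, …, v₄ such that every vertex sees v₁, v₂ alike or v₃, v₄ alike.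
-- Such a G is determined by v₂, v₄, the graph H on the remaining n − 2 vertices, the
-- positions of v₁, v₃ in H, the edge v₂v₄, and for each vertex of H one of three patterns
-- saying which of its adjacencies to v₂, v₄ copy (rather than negate) those to v₁, v₃.
-- So at most n²(n−2)²·3^(n−2)·2^(1 + C(n−2,2)) graphs on n vertices are separated, a
-- fraction n²(n−2)²(3/4)^(n−2) of all 2^C(n,2), which tends to 0.

module Submission where

open import Defs
open import Data.Nat using (ℕ; zero; suc; _+_; _*_; _^_; _≤_; s≤s; NonZero)
open import Data.Nat.Properties
  using ( ≤-refl; ≤-trans; m≤m+n; m≤n+m; *-assoc; *-mono-≤; *-monoˡ-≤; *-monoʳ-≤; *-cancelˡ-≤
        ; ^-monoʳ-≤; ^-distribˡ-+-*; ^-*-assoc; m≤n⇒∃[o]m+o≡n; <-≤-trans; ≮⇒≥; *-commutativeSemigroup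
        ; module ≤-Reasoning )
open import Data.Nat.Solver using (module +-*-Solver)
open import Data.Nat.Tactic.RingSolver using (solve-∀)
open import Data.Nat.Combinatorics using (_C_; nCk+nC[k+1]≡[n+1]C[k+1]; nC1≡n)
open import Algebra.Properties.CommutativeSemigroup *-commutativeSemigroup
  using (x∙yz≈y∙xz; xy∙z≈y∙xz)
open import Data.Bool using (Bool; true; false; not)
open import Data.Fin using (Fin; zero; suc; _≟_) renaming (_<_ to _<ᶠ_)
open import Data.Fin.Properties using (_<?_; <-trans; <-asym; <⇒≢)
open import Data.Fin.Permutation
  using (Permutation′; _⟨$⟩ʳ_; _⟨$⟩ˡ_; inverseˡ; inverseʳ; transpose; _∘ₚ_)
import Data.Fin.Permutation.Components as PC
open import Data.Vec using (Vec; []; _∷_; tabulate; lookup)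
open import Data.Vec.Properties using (tabulate∘lookup; lookup∘tabulate; tabulate-cong)
open import Data.List using (List; []; _∷_; [_]; map; length; allFin; cartesianProductWith)
open import Data.List.Properties using (length-++; length-map; length-tabulate)
open import Data.List.Membership.Propositional using (_∈_)
open import Data.List.Membership.Propositional.Properties
  using (∈-cartesianProductWith⁺; ∈-allFin; ∈-map⁺)
open import Data.List.Relation.Unary.Any using (here; there)
open import Data.Unit using (tt)
open import Data.Empty using (⊥-elim)
open import Data.Product using (Σ; ∃; ∃-syntax; _×_; _,_; proj₁; proj₂)
open import Data.Sum using (_⊎_; inj₁; inj₂)
import Data.Sum as Sum
open import Function using (_∘_)
open import Relation.Nullary using (yes; no)
open import Relation.Nullary.Decidable using (dec-true; dec-false)
open import Relation.Binary.PropositionalEquality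
  using (_≡_; _≢_; refl; sym; trans; cong; cong₂; subst; module ≡-Reasoning)

private variable
  A B R : Set
  a b m n : ℕ

quintic-step : ∀ j → 3 * (19 + j) ^ 5 ≤ 4 * (18 + j) ^ 5
quintic-step j = subst (3 * (19 + j) ^ 5 ≤_) (expansion j) (m≤m+n _ _)
  where
  open +-*-Solver
  -- (19/18)^5 < 4/3: the difference 4 (18 + j)^5 ∸ 3 (19 + j)^5 has nonnegative coefficients.
  expansion : ∀ j → 3 * (19 + j) ^ 5
      + (j ^ 5 + 75 * j ^ 4 + 2130 * j ^ 3 + 27510 * j ^ 2 + 144705 * j + 129975)
    ≡ 4 * (18 + j) ^ 5
  expansion = solve 1 (λ j → con 3 :* (con 19 :+ j) :^ 5
      :+ (j :^ 5 :+ con 75 :* j :^ 4 :+ con 2130 :* j :^ 3 :+ con 27510 :* j :^ 2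
          :+ con 144705 :* j :+ con 129975)
    := con 4 :* (con 18 :+ j) :^ 5) refl

[18+j]^5*3^j≤18^5*4^j : ∀ j → (18 + j) ^ 5 * 3 ^ j ≤ 18 ^ 5 * 4 ^ j
[18+j]^5*3^j≤18^5*4^j zero    = ≤-refl
[18+j]^5*3^j≤18^5*4^j (suc j) = begin
  (19 + j) ^ 5 * (3 * 3 ^ j)  ≡⟨ x∙yz≈y∙xz ((19 + j) ^ 5) 3 (3 ^ j) ⟩
  3 * ((19 + j) ^ 5 * 3 ^ j)  ≡⟨ *-assoc 3 ((19 + j) ^ 5) (3 ^ j) ⟨
  3 * (19 + j) ^ 5 * 3 ^ j    ≤⟨ *-monoˡ-≤ (3 ^ j) (quintic-step j) ⟩
  4 * (18 + j) ^ 5 * 3 ^ j    ≡⟨ *-assoc 4 ((18 + j) ^ 5) (3 ^ j) ⟩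
  4 * ((18 + j) ^ 5 * 3 ^ j)  ≤⟨ *-monoʳ-≤ 4 ([18+j]^5*3^j≤18^5*4^j j) ⟩
  4 * (18 ^ 5 * 4 ^ j)        ≡⟨ x∙yz≈y∙xz 4 (18 ^ 5) (4 ^ j) ⟩
  18 ^ 5 * (4 * 4 ^ j)        ∎
  where open ≤-Reasoning

[18+j]^5*3^[16+j]≤18^5*3^16*4^[16+j] : ∀ j →
  (18 + j) ^ 5 * 3 ^ (16 + j) ≤ 18 ^ 5 * 3 ^ 16 * 4 ^ (16 + j)
[18+j]^5*3^[16+j]≤18^5*3^16*4^[16+j] j = begin
  (18 + j) ^ 5 * 3 ^ (16 + j)      ≡⟨ cong ((18 + j) ^ 5 *_) (^-distribˡ-+-* 3 16 j) ⟩
  (18 + j) ^ 5 * (3 ^ 16 * 3 ^ j)  ≡⟨ x∙yz≈y∙xz ((18 + j) ^ 5) (3 ^ 16) (3 ^ j) ⟩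
  3 ^ 16 * ((18 + j) ^ 5 * 3 ^ j)  ≤⟨ *-monoʳ-≤ (3 ^ 16) ([18+j]^5*3^j≤18^5*4^j j) ⟩
  3 ^ 16 * (18 ^ 5 * 4 ^ j)        ≡⟨ xy∙z≈y∙xz (18 ^ 5) (3 ^ 16) (4 ^ j) ⟨
  18 ^ 5 * 3 ^ 16 * 4 ^ j          ≤⟨ *-monoʳ-≤ (18 ^ 5 * 3 ^ 16) (^-monoʳ-≤ 4 (m≤n+m j 16)) ⟩
  18 ^ 5 * 3 ^ 16 * 4 ^ (16 + j)   ∎
  where open ≤-Reasoning

-- Opaque so that the conversion checker never unfolds a product with this 14-digit literal.
opaque
  κ : ℕ
  κ = 18 ^ 5 * 3 ^ 16

opaque
  unfolding κ

  instance
    κ-nonZero : NonZero κ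
    κ-nonZero = _

  [2+m]^5*3^m≤κ*4^m : ∀ m → 16 ≤ m → (2 + m) ^ 5 * 3 ^ m ≤ κ * 4 ^ m
  [2+m]^5*3^m≤κ*4^m m 16≤m = let j , 16+j≡m = m≤n⇒∃[o]m+o≡n 16≤m in
    subst (λ m → (2 + m) ^ 5 * 3 ^ m ≤ κ * 4 ^ m) 16+j≡m ([18+j]^5*3^[16+j]≤18^5*3^16*4^[16+j] j)

k*[2+m]^4*3^m≤4^m : ∀ k → ∃ λ N → ∀ m → N ≤ m → k * ((2 + m) ^ 4 * 3 ^ m) ≤ 4 ^ m
k*[2+m]^4*3^m≤4^m k = 16 + k * κ , bound
  where
  bound : ∀ m → 16 + k * κ ≤ m → k * ((2 + m) ^ 4 * 3 ^ m) ≤ 4 ^ m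
  bound m N≤m = *-cancelˡ-≤ κ (begin
    κ * (k * X)          ≡⟨ x∙yz≈y∙xz κ k X ⟩
    k * (κ * X)          ≡⟨ *-assoc k κ X ⟨
    k * κ * X            ≤⟨ *-monoˡ-≤ X kκ≤2+m ⟩
    (2 + m) * X          ≡⟨ *-assoc (2 + m) ((2 + m) ^ 4) (3 ^ m) ⟨
    (2 + m) ^ 5 * 3 ^ m  ≤⟨ [2+m]^5*3^m≤κ*4^m m (≤-trans (m≤m+n 16 (k * κ)) N≤m) ⟩
    κ * 4 ^ m            ∎)
    where
    open ≤-Reasoning
    X = (2 + m) ^ 4 * 3 ^ m
    kκ≤2+m : k * κ ≤ 2 + m
    kκ≤2+m = ≤-trans (m≤n+m (k * κ) 16) (≤-trans N≤m (m≤n+m m 2))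

[1+m]C2 : ∀ m → suc m C 2 ≡ m + m C 2
[1+m]C2 m = trans (sym (nCk+nC[k+1]≡[n+1]C[k+1] m 1)) (cong (_+ m C 2) (nC1≡n m))

2^[2+m]C2 : ∀ m → 2 ^ ((2 + m) C 2) ≡ 4 ^ m * (2 * 2 ^ (m C 2))
2^[2+m]C2 m = begin
  2 ^ ((2 + m) C 2)                ≡⟨ cong (2 ^_) (trans ([1+m]C2 (suc m)) (cong (suc m +_) ([1+m]C2 m))) ⟩
  2 ^ (suc m + (m + m C 2))        ≡⟨ cong (2 ^_) (regroup m (m C 2)) ⟩
  2 ^ (2 * m + suc (m C 2))        ≡⟨ ^-distribˡ-+-* 2 (2 * m) (suc (m C 2)) ⟩
  2 ^ (2 * m) * 2 ^ suc (m C 2)    ≡⟨ cong (_* 2 ^ suc (m C 2)) (^-*-assoc 2 2 m) ⟨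
  4 ^ m * (2 * 2 ^ (m C 2))        ∎
  where
  open ≡-Reasoning
  regroup : ∀ m c → suc m + (m + c) ≡ 2 * m + suc c
  regroup = solve-∀

length-cartesianProductWith : (f : A → B → R) (xs : List A) (ys : List B) →
  length (cartesianProductWith f xs ys) ≡ length xs * length ys
length-cartesianProductWith f []       ys = refl
length-cartesianProductWith f (x ∷ xs) ys = trans (length-++ (map (f x) ys))
  (cong₂ _+_ (length-map (f x) ys) (length-cartesianProductWith f xs ys))

record Enumeration (A : Set) (size : ℕ) : Set where
  field
    elements : List A
    complete : ∀ x → x ∈ elements
    length-elements : length elements ≡ size

open Enumeration

resize : a ≡ b → Enumeration A a → Enumeration A b
resize a≡b E = record
  { elements = elements E ; complete = complete E ; length-elements = trans (length-elements E) a≡b }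

Fin-enumeration : ∀ n → Enumeration (Fin n) n
Fin-enumeration n = record
  { elements = allFin n ; complete = ∈-allFin ; length-elements = length-tabulate (λ i → i) }

Bool-enumeration : Enumeration Bool 2
Bool-enumeration = record
  { elements = true ∷ false ∷ [] ; complete = λ { true → here refl ; false → there (here refl) }
  ; length-elements = refl }

infixr 2 _×-enumeration_
_×-enumeration_ : Enumeration A a → Enumeration B b → Enumeration (A × B) (a * b)
E ×-enumeration F = record
  { elements = cartesianProductWith _,_ (elements E) (elements F)
  ; complete = λ (x , y) → ∈-cartesianProductWith⁺ _,_ (complete E x) (complete F y)
  ; length-elements = trans (length-cartesianProductWith _,_ (elements E) (elements F))
                            (cong₂ _*_ (length-elements E) (length-elements F))
  }

Vec-enumeration : Enumeration A a → ∀ n → Enumeration (Vec A n) (a ^ n)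
Vec-enumeration E zero    = record { elements = [ [] ] ; complete = λ { [] → here refl } ; length-elements = refl }
Vec-enumeration E (suc n) = record
  { elements = cartesianProductWith _∷_ (elements E) (elements Eⁿ)
  ; complete = λ { (x ∷ xs) → ∈-cartesianProductWith⁺ _∷_ (complete E x) (complete Eⁿ xs) }
  ; length-elements = trans (length-cartesianProductWith _∷_ (elements E) (elements Eⁿ))
                            (cong₂ _*_ (length-elements E) (length-elements Eⁿ))
  }
  where Eⁿ = Vec-enumeration E n

LGraph-enumeration : ∀ n → Enumeration (LGraph n) (2 ^ (n C 2))
LGraph-enumeration zero    = record { elements = [ tt ] ; complete = λ { tt → here refl } ; length-elements = refl }
LGraph-enumeration (suc n) =
  resize (trans (sym (^-distribˡ-+-* 2 n (n C 2))) (cong (2 ^_) (sym ([1+m]C2 n))))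
    (Vec-enumeration Bool-enumeration n ×-enumeration LGraph-enumeration n)

fromAdj : (Fin n → Fin n → Bool) → LGraph n
fromAdj {zero}  f = tt
fromAdj {suc n} f = tabulate (f zero ∘ suc) , fromAdj (λ i j → f (suc i) (suc j))

fromAdj∘adj : (G : LGraph n) → fromAdj (adj G) ≡ G
fromAdj∘adj {zero}  tt      = refl
fromAdj∘adj {suc n} (v , G) = cong₂ _,_ (tabulate∘lookup v) (fromAdj∘adj G)

fromAdj-cong : {f g : Fin n → Fin n → Bool} → (∀ i j → f i j ≡ g i j) → fromAdj f ≡ fromAdj g
fromAdj-cong {zero}  f≗g = refl
fromAdj-cong {suc n} f≗g =
  cong₂ _,_ (tabulate-cong (f≗g zero ∘ suc)) (fromAdj-cong (λ i j → f≗g (suc i) (suc j)))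

adj∘fromAdj : (f : Fin n → Fin n → Bool) → (∀ i j → f i j ≡ f j i) → (∀ i → f i i ≡ false) →
              ∀ i j → adj (fromAdj f) i j ≡ f i j
adj∘fromAdj {suc n} f sym-f irr-f zero    zero    = sym (irr-f zero)
adj∘fromAdj {suc n} f sym-f irr-f zero    (suc j) = lookup∘tabulate (f zero ∘ suc) j
adj∘fromAdj {suc n} f sym-f irr-f (suc i) zero    =
  trans (lookup∘tabulate (f zero ∘ suc) i) (sym-f zero (suc i))
adj∘fromAdj {suc n} f sym-f irr-f (suc i) (suc j) =
  adj∘fromAdj (λ i j → f (suc i) (suc j)) (λ i j → sym-f (suc i) (suc j)) (irr-f ∘ suc) i j

adj-sym : (G : LGraph n) → ∀ i j → adj G i j ≡ adj G j i
adj-sym {suc n} G       zero    zero    = refl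
adj-sym {suc n} G       zero    (suc j) = refl
adj-sym {suc n} G       (suc i) zero    = refl
adj-sym {suc n} (v , G) (suc i) (suc j) = adj-sym G i j

adj-irrefl : (G : LGraph n) → ∀ i → adj G i i ≡ false
adj-irrefl {suc n} G       zero    = refl
adj-irrefl {suc n} (v , G) (suc i) = adj-irrefl G i

relabel : (Fin n → Fin n) → LGraph n → LGraph n
relabel f G = fromAdj (λ x y → adj G (f x) (f y))

adj-relabel : ∀ (f : Fin n → Fin n) G x y → adj (relabel f G) x y ≡ adj G (f x) (f y)
adj-relabel f G = adj∘fromAdj _ (λ x y → adj-sym G (f x) (f y)) (λ x → adj-irrefl G (f x))

relabel-inverse : (f g : Fin n → Fin n) → (∀ x → f (g x) ≡ x) → ∀ G → relabel g (relabel f G) ≡ G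
relabel-inverse f g f∘g≗id G = trans
  (fromAdj-cong λ x y → trans (adj-relabel f G (g x) (g y)) (cong₂ (adj G) (f∘g≗id x) (f∘g≗id y)))
  (fromAdj∘adj G)

record SeparatedQuadruple (G : LGraph n) (v₁ v₂ v₃ v₄ : Fin n) : Set where
  field
    v₁≢v₂ : v₁ ≢ v₂
    v₁≢v₄ : v₁ ≢ v₄
    v₃≢v₂ : v₃ ≢ v₂
    v₃≢v₄ : v₃ ≢ v₄
    v₂≢v₄ : v₂ ≢ v₄
    alike : ∀ y → adj G y v₁ ≡ adj G y v₂ ⊎ adj G y v₃ ≡ adj G y v₄

open SeparatedQuadruple

relabel-quadruple : ∀ (f : Fin n → Fin n) {G a b c d v₁ v₂ v₃ v₄} →
  f a ≡ v₁ → f b ≡ v₂ → f c ≡ v₃ → f d ≡ v₄ →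
  SeparatedQuadruple G v₁ v₂ v₃ v₄ → SeparatedQuadruple (relabel f G) a b c d
relabel-quadruple f {G} refl refl refl refl q = record
  { v₁≢v₂ = v₁≢v₂ q ∘ cong f
  ; v₁≢v₄ = v₁≢v₄ q ∘ cong f
  ; v₃≢v₂ = v₃≢v₂ q ∘ cong f
  ; v₃≢v₄ = v₃≢v₄ q ∘ cong f
  ; v₂≢v₄ = v₂≢v₄ q ∘ cong f
  ; alike = λ y → Sum.map (transport y) (transport y) (alike q (f y))
  }
  where
  transport : ∀ y {u v} → adj G (f y) (f u) ≡ adj G (f y) (f v) →
              adj (relabel f G) y u ≡ adj (relabel f G) y v
  transport y {u} {v} eq = trans (adj-relabel f G y u) (trans eq (sym (adj-relabel f G y v)))

transpose-matchˡ : (i j : Fin n) → PC.transpose i j i ≡ j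
transpose-matchˡ i j rewrite dec-true (i ≟ i) refl = refl

transpose-mismatch : (i j k : Fin n) → k ≢ i → k ≢ j → PC.transpose i j k ≡ k
transpose-mismatch i j k k≢i k≢j rewrite dec-false (k ≟ i) k≢i | dec-false (k ≟ j) k≢j = refl

toFront : (v₂ v₄ : Fin (suc (suc m))) → Permutation′ (suc (suc m))
toFront v₂ v₄ = transpose (suc zero) (PC.transpose v₂ zero v₄) ∘ₚ transpose zero v₂

toFront-1 : (v₂ v₄ : Fin (suc (suc m))) → toFront v₂ v₄ ⟨$⟩ʳ suc zero ≡ v₄
toFront-1 v₂ v₄ = trans (cong (PC.transpose zero v₂) (transpose-matchˡ (suc zero) (PC.transpose v₂ zero v₄)))
                        (PC.transpose-inverse zero v₂)

toFront-0 : (v₂ v₄ : Fin (suc (suc m))) → v₂ ≢ v₄ → toFront v₂ v₄ ⟨$⟩ʳ zero ≡ v₂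
toFront-0 v₂ v₄ v₂≢v₄ =
  trans (cong (PC.transpose zero v₂) (transpose-mismatch (suc zero) w zero (λ ()) 0≢w)) (transpose-matchˡ zero v₂)
  where
  w = PC.transpose v₂ zero v₄
  0≢w : zero ≢ w
  0≢w 0≡w = v₂≢v₄ (trans (sym (transpose-matchˡ zero v₂))
                    (trans (cong (PC.transpose zero v₂) 0≡w) (PC.transpose-inverse zero v₂)))

rowPair : Fin 3 → Bool → Bool → Bool × Bool
rowPair zero             x y = x     , y
rowPair (suc zero)       x y = x     , not y
rowPair (suc (suc zero)) x y = not x , y

rowPair-complete : ∀ x y a b → x ≡ a ⊎ y ≡ b → ∃[ s ] rowPair s x y ≡ (a , b)
rowPair-complete x true  .x true  (inj₁ refl) = zero , refl
rowPair-complete x true  .x false (inj₁ refl) = suc zero , refl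
rowPair-complete x false .x true  (inj₁ refl) = suc zero , refl
rowPair-complete x false .x false (inj₁ refl) = zero , refl
rowPair-complete true  y true  .y (inj₂ refl) = zero , refl
rowPair-complete true  y false .y (inj₂ refl) = suc (suc zero) , refl
rowPair-complete false y true  .y (inj₂ refl) = suc (suc zero) , refl
rowPair-complete false y false .y (inj₂ refl) = zero , refl

FrontCode : ℕ → Set
FrontCode m = Fin m × Fin m × Vec (Fin 3) m × Bool × LGraph m

assemble : FrontCode m → LGraph (suc (suc m))
assemble {m} (u₁ , u₃ , t , e , H) = (e ∷ tabulate (proj₁ ∘ row)) , tabulate (proj₂ ∘ row) , H
  where
  row : Fin m → Bool × Bool
  row j = rowPair (lookup t j) (adj H j u₁) (adj H j u₃)

assemble-onto : ∀ (G : LGraph (suc (suc m))) x y → SeparatedQuadruple G x zero y (suc zero) →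
                ∃[ c ] assemble c ≡ G
assemble-onto G zero                 y                    q = ⊥-elim (v₁≢v₂ q refl)
assemble-onto G (suc zero)           y                    q = ⊥-elim (v₁≢v₄ q refl)
assemble-onto G (suc (suc u₁))       zero                 q = ⊥-elim (v₃≢v₂ q refl)
assemble-onto G (suc (suc u₁))       (suc zero)           q = ⊥-elim (v₃≢v₄ q refl)
assemble-onto {m} (e ∷ r₀ , r₁ , H) (suc (suc u₁)) (suc (suc u₃)) q =
  (u₁ , u₃ , t , e , H) ,
  cong₂ (λ r₀′ r₁′ → (e ∷ r₀′) , r₁′ , H)
    (trans (tabulate-cong (cong proj₁ ∘ row≡)) (tabulate∘lookup r₀))
    (trans (tabulate-cong (cong proj₂ ∘ row≡)) (tabulate∘lookup r₁))
  where
  choice : ∀ j → ∃[ s ] rowPair s (adj H j u₁) (adj H j u₃) ≡ (lookup r₀ j , lookup r₁ j)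
  choice j = rowPair-complete _ _ _ _ (alike q (suc (suc j)))
  t : Vec (Fin 3) m
  t = tabulate (proj₁ ∘ choice)
  row≡ : ∀ j → rowPair (lookup t j) (adj H j u₁) (adj H j u₃) ≡ (lookup r₀ j , lookup r₁ j)
  row≡ j = trans (cong (λ s → rowPair s (adj H j u₁) (adj H j u₃)) (lookup∘tabulate (proj₁ ∘ choice) j))
                 (proj₂ (choice j))

Code : ℕ → Set
Code m = Fin (suc (suc m)) × Fin (suc (suc m)) × FrontCode m

decode : Code m → LGraph (suc (suc m))
decode (v₂ , v₄ , c) = relabel (toFront v₂ v₄ ⟨$⟩ˡ_) (assemble c)

decode-onto : ∀ (G : LGraph (suc (suc m))) {v₁ v₂ v₃ v₄} → SeparatedQuadruple G v₁ v₂ v₃ v₄ →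
              ∃[ c ] decode c ≡ G
decode-onto G {v₁} {v₂} {v₃} {v₄} q = (v₂ , v₄ , c) , (begin
  relabel ρ (assemble c)   ≡⟨ cong (relabel ρ) assemble-c≡G′ ⟩
  relabel ρ (relabel π G)  ≡⟨ relabel-inverse π ρ (λ _ → inverseʳ σ) G ⟩
  G                        ∎)
  where
  open ≡-Reasoning
  σ = toFront v₂ v₄
  π = σ ⟨$⟩ʳ_
  ρ = σ ⟨$⟩ˡ_
  front : SeparatedQuadruple (relabel π G) (ρ v₁) zero (ρ v₃) (suc zero)
  front = relabel-quadruple π (inverseʳ σ) (toFront-0 v₂ v₄ (v₂≢v₄ q)) (inverseʳ σ) (toFront-1 v₂ v₄) q
  front-code : ∃[ c ] assemble c ≡ relabel π G
  front-code = assemble-onto (relabel π G) (ρ v₁) (ρ v₃) front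
  c = proj₁ front-code
  assemble-c≡G′ = proj₂ front-code

letterAdj-< : ∀ (D : Decoder m) (w : Word m n) {i j} → i <ᶠ j → letterAdj D w i j ≡ D (w i) (w j)
letterAdj-< D w {i} {j} i<j with i <? j
... | yes _   = refl
... | no i≮j = ⊥-elim (i≮j i<j)

letterAdj-> : ∀ (D : Decoder m) (w : Word m n) {i j} → j <ᶠ i → letterAdj D w i j ≡ D (w j) (w i)
letterAdj-> D w {i} {j} j<i with i <? j | j <? i
... | yes i<j | _       = ⊥-elim (<-asym i<j j<i)
... | no _    | yes _   = refl
... | no _    | no j≮i = ⊥-elim (j≮i j<i)

letterAdj-sameLetter-< : ∀ (D : Decoder m) (w : Word m n) {i j k} → i <ᶠ j → i <ᶠ k → w j ≡ w k →
                         letterAdj D w i j ≡ letterAdj D w i k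
letterAdj-sameLetter-< D w {i} i<j i<k wj≡wk =
  trans (letterAdj-< D w i<j) (trans (cong (D (w i)) wj≡wk) (sym (letterAdj-< D w i<k)))

letterAdj-sameLetter-> : ∀ (D : Decoder m) (w : Word m n) {i j k} → j <ᶠ i → k <ᶠ i → w j ≡ w k →
                         letterAdj D w i j ≡ letterAdj D w i k
letterAdj-sameLetter-> D w {i} j<i k<i wj≡wk =
  trans (letterAdj-> D w j<i) (trans (cong (λ a → D a (w i)) wj≡wk) (sym (letterAdj-> D w k<i)))

separated⇒quadruple : ∀ (G : LGraph n) → HasSeparatedLettering G →
  ∃ λ v₁ → ∃ λ v₂ → ∃ λ v₃ → ∃ λ v₄ → SeparatedQuadruple G v₁ v₂ v₃ v₄
separated⇒quadruple G (_ , w , (D , σ , iso) , _ , _ , _ , p₁ , p₂ , p₃ , p₄ ,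
                      (p₁<p₂ , wp₁≡a , wp₂≡a , _) , (p₃<p₄ , wp₃≡b , wp₄≡b , _) , p₂<p₃) =
  S p₁ , S p₂ , S p₃ , S p₄ , record
  { v₁≢v₂ = S-injective (<⇒≢ p₁<p₂)
  ; v₁≢v₄ = S-injective (<⇒≢ (<-trans p₁<p₂ p₂<p₄))
  ; v₃≢v₂ = S-injective (<⇒≢ p₂<p₃ ∘ sym)
  ; v₃≢v₄ = S-injective (<⇒≢ p₃<p₄)
  ; v₂≢v₄ = S-injective (<⇒≢ p₂<p₄)
  ; alike = sees-alike
  }
  where
  S = σ ⟨$⟩ʳ_
  p₂<p₄ = <-trans p₂<p₃ p₃<p₄
  S-injective : ∀ {x y} → x ≢ y → S x ≢ S y
  S-injective x≢y Sx≡Sy = x≢y (trans (sym (inverseˡ σ)) (trans (cong (σ ⟨$⟩ˡ_) Sx≡Sy) (inverseˡ σ)))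
  adj-S : ∀ y p → adj G y (S p) ≡ letterAdj D w (σ ⟨$⟩ˡ y) p
  adj-S y p = trans (cong (λ z → adj G z (S p)) (sym (inverseʳ σ))) (iso (σ ⟨$⟩ˡ y) p)
  sees-alike : ∀ y → adj G y (S p₁) ≡ adj G y (S p₂) ⊎ adj G y (S p₃) ≡ adj G y (S p₄)
  sees-alike y with σ ⟨$⟩ˡ y <? p₃
  ... | yes x<p₃ = inj₂ (trans (adj-S y p₃) (trans
          (letterAdj-sameLetter-< D w x<p₃ (<-trans x<p₃ p₃<p₄) (trans wp₃≡b (sym wp₄≡b)))
          (sym (adj-S y p₄))))
  ... | no x≮p₃ = inj₁ (trans (adj-S y p₁) (trans
          (letterAdj-sameLetter-> D w (<-trans p₁<p₂ p₂<x) p₂<x (trans wp₁≡a (sym wp₂≡a)))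
          (sym (adj-S y p₂))))
    where p₂<x = <-≤-trans p₂<p₃ (≮⇒≥ x≮p₃)

count-Code≤2^[2+m]C2 : ∀ k m → k * ((2 + m) ^ 4 * 3 ^ m) ≤ 4 ^ m →
  k * ((2 + m) * ((2 + m) * (m * (m * (3 ^ m * (2 * 2 ^ (m C 2))))))) ≤ 2 ^ ((2 + m) C 2)
count-Code≤2^[2+m]C2 k m bound = begin
  k * (v * (v * (m * (m * (3 ^ m * P)))))  ≡⟨ regroup k v m (3 ^ m) P ⟩
  k * (v * (v * (m * (m * 1))) * 3 ^ m) * P ≤⟨ *-monoˡ-≤ P (*-monoʳ-≤ k (*-monoˡ-≤ (3 ^ m) v²m²≤v⁴)) ⟩
  k * (v ^ 4 * 3 ^ m) * P                   ≤⟨ *-monoˡ-≤ P bound ⟩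
  4 ^ m * P                                 ≡⟨ 2^[2+m]C2 m ⟨
  2 ^ ((2 + m) C 2)                         ∎
  where
  open ≤-Reasoning
  v = 2 + m
  P = 2 * 2 ^ (m C 2)
  m≤v = m≤n+m m 2
  v²m²≤v⁴ : v * (v * (m * (m * 1))) ≤ v ^ 4
  v²m²≤v⁴ = *-monoʳ-≤ v (*-monoʳ-≤ v (*-mono-≤ m≤v (*-mono-≤ m≤v ≤-refl)))
  regroup : ∀ k n m t p → k * (n * (n * (m * (m * (t * p))))) ≡ k * (n * (n * (m * (m * 1))) * t) * p
  regroup = solve-∀

Code-enumeration : ∀ m →
  Enumeration (Code m) ((2 + m) * ((2 + m) * (m * (m * (3 ^ m * (2 * 2 ^ (m C 2)))))))
Code-enumeration m =
  Fin-enumeration (2 + m) ×-enumeration Fin-enumeration (2 + m) ×-enumeration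
  Fin-enumeration m ×-enumeration Fin-enumeration m ×-enumeration
  Vec-enumeration (Fin-enumeration 3) m ×-enumeration Bool-enumeration ×-enumeration LGraph-enumeration m

separatedCandidates : ∀ m → List (LGraph (2 + m))
separatedCandidates m = map decode (elements (Code-enumeration m))

separated∈separatedCandidates : ∀ m (G : LGraph (2 + m)) → HasSeparatedLettering G → G ∈ separatedCandidates m
separated∈separatedCandidates m G sep with separated⇒quadruple G sep
... | _ , _ , _ , _ , q with decode-onto G q
...   | c , decode-c≡G = subst (_∈ separatedCandidates m) decode-c≡G
                           (∈-map⁺ decode (complete (Code-enumeration m) c))

length-separatedCandidates : ∀ m →
  length (separatedCandidates m) ≡ (2 + m) * ((2 + m) * (m * (m * (3 ^ m * (2 * 2 ^ (m C 2))))))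
length-separatedCandidates m =
  trans (length-map decode (elements (Code-enumeration m))) (length-elements (Code-enumeration m))

proposition5 : (k : ℕ) → Σ ℕ λ N → (n : ℕ) → N ≤ n →
    Σ (List (LGraph n)) λ L →
    ((G : LGraph n) → HasSeparatedLettering G → G ∈ L) ×
    k * length L ≤ 2 ^ (n C 2)
proposition5 k = 2 + N , λ
  { (suc (suc m)) (s≤s (s≤s N≤m)) →
      separatedCandidates m ,
      separated∈separatedCandidates m ,
      subst (λ ℓ → k * ℓ ≤ 2 ^ ((2 + m) C 2)) (sym (length-separatedCandidates m))
        (count-Code≤2^[2+m]C2 k m (eventually m N≤m)) }
  where
  N = proj₁ (k*[2+m]^4*3^m≤4^m k)
  eventually = proj₂ (k*[2+m]^4*3^m≤4^m k)
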